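{- For every $\mathrm{BL}$ formula $A$: if $A$ is provable in $\mathrm{TBL}$, then $A$ is valid in $\mathrm{BL}$.
   Context: $\mathrm{BL}$: formulae $A ::= p \mid \neg A \mid A\wedge A \mid \Box A \mid A \ast A \mid A \mathrel{ -\!\!\ast} A$ over countably many letters. A $\mathrm{BL}$ model is $(W,\le,R,V)$ with $(W,\le)$ a rooted partial order with persistent separation (writing $w_1\bowtie w_2$ for "neither $w_1\le w_2$ nor $w_2\le w_1$": if $w_1\bowtie w_2$ and $w_1\le w_1'$ then $w_1'\bowtie w_2$), $R(w,w_1,w_2)$ iff $w\le w_1$, $w\le w_2$, $w_1\bowtie w_2$, and $V$ a valuation; satisfaction classical for $p,\neg,\wedge$; $w\Vdash\Box A$ iff $A$ holds at every $w'\ge w$; $w\Vdash A\ast B$ iff $\exists w_1,w_2$: $R(w,w_1,w_2)$, $w_1\Vdash A$, $w_2\Vdash B$; $w\Vdash A\mathrel{ -\!\!\ast}B$ iff $\forall w_1,w_2$: if $R(w_2,w,w_1)$ and $w_1\Vdash A$ then $w_2\Vdash B$. $A$ is valid if it holds at every world of every $\mathrm{BL}$ model. $\mathrm{TBL}$: nodes are signed labelled formulae $\mathsf S A:x$ ($\mathsf S\in\{\mathsf T,\mathsf F\}$, $x$ from a countable set of labels) and signed constraints $\mathsf T\,x\le y$, $\mathsf F\,x\le y$; $\mathsf T\,x\bowtie y$ abbreviates $\mathsf F\,x\le y,\mathsf F\,y\le x$ and $\mathsf T\,R(x,y,z)$ abbreviates $\mathsf T\,x\le y,\mathsf T\,x\le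 z,\mathsf T\,y\bowtie z$. A tableau for $A:x$ is a finitely branching rooted tree with root $\mathsf F A:x$ built by rules that, when their premises occur on a branch, extend it by their conclusions (splitting on "$\mid$"); $u,v$ denote distinct fresh labels. Rules: $\mathsf F\neg A:x\Rightarrow\mathsf T A:x$; $\mathsf T\neg A:x\Rightarrow\mathsf F A:x$; $\mathsf T A\wedge B:x\Rightarrow\mathsf T A:x,\mathsf T B:x$; $\mathsf F A\wedge B:x\Rightarrow\mathsf F A:x\mid\mathsf F B:x$; $\mathsf F\Box A:x\Rightarrow\mathsf T\,x\le u,\mathsf F A:u$; $\mathsf T\Box A:x,\mathsf T\,x\le y\Rightarrow\mathsf T A:y$; $\mathsf T A\ast B:x\Rightarrow\mathsf T\,R(x,u,v),\mathsf T A:u,\mathsf T B:v$; $\mathsf F A\ast B:x,\mathsf T\,R(x,y,z)\Rightarrow\mathsf F A:y\mid\mathsf F B:z$; $\mathsf T A\mathrel{ -\!\!\ast}B:x,\mathsf T\,R(z,x,y)\Rightarrow\mathsf F A:y\mid\mathsf T B:z$; $\mathsf F A\mathrel{ -\!\!\ast}B:x\Rightarrow\mathsf T\,R(v,x,u),\mathsf T A:u,\mathsf F B:v$; $\mathsf S A:x,\mathsf T\,x\le y,\mathsf T\,y\le x\Rightarrow\mathsf S A:y$; $\mathsf S A:x,\mathsf S' B:y\Rightarrow\mathsf T\,x\le y\mid\mathsf T\,y\le x\mid\mathsf T\,x\bowtie y$; $\mathsf S A:x\Rightarrow\mathsf T\,x\le x$; $\mathsf T\,x\le y,\mathsf T\,y\le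 z\Rightarrow\mathsf T\,x\le z$; $\mathsf T\,x_1\bowtie x_2,\mathsf T\,x_i\le y\Rightarrow\mathsf T\,x_j\bowtie y$ ($i\in\{1,2\},j=3-i$). A branch is closed if it contains $\mathsf T A:x$ and $\mathsf F A:x$, or $\mathsf T\,x\le y$ and $\mathsf F\,x\le y$; a tableau is closed if all branches are closed. $A$ is provable in $\mathrm{TBL}$ if for some label $x$ there is a closed tableau for $A:x$. -}

module Defs where

open import Level using (0ℓ)
open import Data.Nat using (ℕ)
open import Data.List using (List; []; _∷_)
open import Data.List.Membership.Propositional using (_∈_)
open import Data.List.Relation.Unary.All using (All)
open import Data.Product using (Σ; ∃; _×_; _,_)
open import Data.Sum using (_⊎_)
open import Relation.Nullary using (¬_)
open import Relation.Binary.PropositionalEquality using (_≡_; _≢_)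
open import Relation.Binary.Structures using (IsPartialOrder)

infixr 6 _∧_
infixr 5 _✱_ _-✱_

data Formula : Set where
  var  : ℕ → Formula
  ¬'_  : Formula → Formula
  _∧_  : Formula → Formula → Formula
  □_   : Formula → Formula
  _✱_  : Formula → Formula → Formula
  _-✱_ : Formula → Formula → Formula

record Model : Set₁ where
  field
    W       : Set
    _≤_     : W → W → Set
    isPO    : IsPartialOrder _≡_ _≤_
    root    : W
    rooted  : ∀ w → root ≤ w
    V       : ℕ → W → Set

  _⋈_ : W → W → Set
  w₁ ⋈ w₂ = ¬ (w₁ ≤ w₂) × ¬ (w₂ ≤ w₁)

  field
    persistent : ∀ w₁ w₂ w₁' → w₁ ⋈ w₂ → w₁ ≤ w₁' → w₁' ⋈ w₂

  R : W → W → W → Set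
  R w w₁ w₂ = w ≤ w₁ × w ≤ w₂ × w₁ ⋈ w₂

  infix 4 _⊩_
  _⊩_ : W → Formula → Set
  w ⊩ var p    = V p w
  w ⊩ ¬' A     = ¬ (w ⊩ A)
  w ⊩ A ∧ B    = (w ⊩ A) × (w ⊩ B)
  w ⊩ □ A      = ∀ w' → w ≤ w' → w' ⊩ A
  w ⊩ A ✱ B    = Σ W λ w₁ → Σ W λ w₂ → R w w₁ w₂ × (w₁ ⊩ A) × (w₂ ⊩ B)
  w ⊩ A -✱ B   = ∀ w₁ w₂ → R w₂ w w₁ → w₁ ⊩ A → w₂ ⊩ B

Valid : Formula → Set₁
Valid A = (M : Model) (w : Model.W M) → Model._⊩_ M w A

data Sign : Set where
  T F : Sign

data Node : Set where
  lab  : Sign → Formula → ℕ → Node   -- S A : x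
  le   : Sign → ℕ → ℕ → Node         -- S x ≤ y

Branch : Set
Branch = List Node

Occurs : ℕ → Node → Set
Occurs u (lab _ _ x) = u ≡ x
Occurs u (le _ x y)  = u ≡ x ⊎ u ≡ y

Fresh : ℕ → Branch → Set
Fresh u Γ = All (λ n → ¬ Occurs u n) Γ

-- T R(x,y,z) as the list of nodes T x≤y, T x≤z, F y≤z, F z≤y
TR : ℕ → ℕ → ℕ → List Node
TR x y z = le T x y ∷ le T x z ∷ le F y z ∷ le F z y ∷ []

infixr 5 _++'_
_++'_ : List Node → Branch → Branch
[] ++' Γ = Γ
(n ∷ ns) ++' Γ = n ∷ (ns ++' Γ)

-- Closes Γ : the branch Γ can be extended, by applications of the TBL
-- rules, to a finite tree all of whose branches are closed.
data Closes (Γ : Branch) : Set where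
  closeF : ∀ {A x} → lab T A x ∈ Γ → lab F A x ∈ Γ → Closes Γ
  closeC : ∀ {x y} → le T x y ∈ Γ → le F x y ∈ Γ → Closes Γ
  F¬ : ∀ {A x} → lab F (¬' A) x ∈ Γ → Closes (lab T A x ∷ Γ) → Closes Γ
  T¬ : ∀ {A x} → lab T (¬' A) x ∈ Γ → Closes (lab F A x ∷ Γ) → Closes Γ
  T∧ : ∀ {A B x} → lab T (A ∧ B) x ∈ Γ →
       Closes (lab T A x ∷ lab T B x ∷ Γ) → Closes Γ
  F∧ : ∀ {A B x} → lab F (A ∧ B) x ∈ Γ →
       Closes (lab F A x ∷ Γ) → Closes (lab F B x ∷ Γ) → Closes Γ
  F□ : ∀ {A x} u → lab F (□ A) x ∈ Γ → Fresh u Γ →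
       Closes (le T x u ∷ lab F A u ∷ Γ) → Closes Γ
  T□ : ∀ {A x y} → lab T (□ A) x ∈ Γ → le T x y ∈ Γ →
       Closes (lab T A y ∷ Γ) → Closes Γ
  T✱ : ∀ {A B x} u v → lab T (A ✱ B) x ∈ Γ → Fresh u Γ → Fresh v Γ → u ≢ v →
       Closes (TR x u v ++' lab T A u ∷ lab T B v ∷ Γ) → Closes Γ
  F✱ : ∀ {A B x y z} → lab F (A ✱ B) x ∈ Γ →
       le T x y ∈ Γ → le T x z ∈ Γ → le F y z ∈ Γ → le F z y ∈ Γ →
       Closes (lab F A y ∷ Γ) → Closes (lab F B z ∷ Γ) → Closes Γ
  T-✱ : ∀ {A B x y z} → lab T (A -✱ B) x ∈ Γ →
       le T z x ∈ Γ → le T z y ∈ Γ → le F x y ∈ Γ → le F y x ∈ Γ →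
       Closes (lab F A y ∷ Γ) → Closes (lab T B z ∷ Γ) → Closes Γ
  F-✱ : ∀ {A B x} u v → lab F (A -✱ B) x ∈ Γ → Fresh u Γ → Fresh v Γ → u ≢ v →
       Closes (TR v x u ++' lab T A u ∷ lab F B v ∷ Γ) → Closes Γ
  eqL : ∀ {S A x y} → lab S A x ∈ Γ → le T x y ∈ Γ → le T y x ∈ Γ →
       Closes (lab S A y ∷ Γ) → Closes Γ
  cmp : ∀ {S S' A B x y} → lab S A x ∈ Γ → lab S' B y ∈ Γ →
       Closes (le T x y ∷ Γ) → Closes (le T y x ∷ Γ) →
       Closes (le F x y ∷ le F y x ∷ Γ) → Closes Γ
  refl≤ : ∀ {S A x} → lab S A x ∈ Γ → Closes (le T x x ∷ Γ) → Closes Γ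
  trans≤ : ∀ {x y z} → le T x y ∈ Γ → le T y z ∈ Γ →
       Closes (le T x z ∷ Γ) → Closes Γ
  -- T x₁ ⋈ x₂ , T x₁ ≤ y ⇒ T x₂ ⋈ y  (the case i = 2 is the same rule
  -- with x₁, x₂ swapped, since T x₁ ⋈ x₂ is symmetric)
  sep : ∀ {x₁ x₂ y} → le F x₁ x₂ ∈ Γ → le F x₂ x₁ ∈ Γ → le T x₁ y ∈ Γ →
       Closes (le F x₂ y ∷ le F y x₂ ∷ Γ) → Closes Γ

ProvableTBL : Formula → Set
ProvableTBL A = ∃ λ x → Closes (lab F A x ∷ [])

{-# OPTIONS --safe #-}
module Submission where

open import Defs
open import Level using (0ℓ)
open import Axiom.ExcludedMiddle using (ExcludedMiddle)
open import Axiom.DoubleNegationElimination using (DoubleNegationElimination; em⇒dne)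
open import Data.Nat using (ℕ; _≟_)
open import Data.List using ([]; _∷_)
open import Data.List.Membership.Propositional using (_∈_)
open import Data.List.Relation.Unary.All as All using ([]; _∷_; lookup)
open import Data.Product using (_×_; _,_)
open import Data.Sum using (inj₁; inj₂)
open import Data.Empty using (⊥-elim)
open import Relation.Nullary using (¬_; yes; no)
open import Relation.Binary.PropositionalEquality
  using (_≡_; _≢_; refl; sym; trans; subst₂)
open import Relation.Binary.Structures using (IsPartialOrder)

-- No assignment of worlds to labels can make every node of a closable
-- branch true: each rule turns such an assignment into one for one of the
-- extended branches, sending fresh labels to the worlds witnessing a true
-- ✱ or a false □ or -✱.  As the goal is always ⊥, branching needs no
-- classical logic; double negation elimination is used only to extract
-- the witnesses of a false □ or -✱, and to get validity from the fact
-- that F A : x is unrealisable.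

⟦_⟧ : Sign → Set → Set
⟦ T ⟧ P = P
⟦ F ⟧ P = ¬ P

module Soundness (dne : DoubleNegationElimination 0ℓ) (M : Model) where
  open Model M
  open IsPartialOrder isPO using (antisym) renaming (refl to ≤-refl; trans to ≤-trans)

  Assignment : Set
  Assignment = ℕ → W

  Holds : Assignment → Node → Set
  Holds ρ (lab S A x) = ⟦ S ⟧ (ρ x ⊩ A)
  Holds ρ (le S x y)  = ⟦ S ⟧ (ρ x ≤ ρ y)

  Realises : Assignment → Branch → Set
  Realises ρ Γ = All.All (Holds ρ) Γ

  Unrealisable : Branch → Set
  Unrealisable Γ = ∀ ρ → ¬ Realises ρ Γ

  _[_≔_] : Assignment → ℕ → W → Assignment
  (ρ [ u ≔ w ]) y with y ≟ u
  ... | yes _ = w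
  ... | no _  = ρ y

  update-≡ : ∀ ρ u w → (ρ [ u ≔ w ]) u ≡ w
  update-≡ ρ u w with u ≟ u
  ... | yes _   = refl
  ... | no u≢u  = ⊥-elim (u≢u refl)

  update-≢ : ∀ ρ {u} w {y} → y ≢ u → (ρ [ u ≔ w ]) y ≡ ρ y
  update-≢ ρ {u} w {y} y≢u with y ≟ u
  ... | yes y≡u = ⊥-elim (y≢u y≡u)
  ... | no _    = refl

  ⊩-resp : ∀ S A {a b} → a ≡ b → ⟦ S ⟧ (b ⊩ A) → ⟦ S ⟧ (a ⊩ A)
  ⊩-resp _ _ refl h = h

  ≤-resp : ∀ {a a′ b b′} → a ≡ a′ → b ≡ b′ → a′ ≤ b′ → a ≤ b
  ≤-resp refl refl h = h

  Holds-cong : ∀ {ρ σ} n → (∀ {y} → Occurs y n → σ y ≡ ρ y) → Holds ρ n → Holds σ n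
  Holds-cong (lab S A x) eq h = ⊩-resp S A (eq refl) h
  Holds-cong (le S x y)  eq h =
    subst₂ (λ a b → ⟦ S ⟧ (a ≤ b)) (sym (eq (inj₁ refl))) (sym (eq (inj₂ refl))) h

  Realises-update : ∀ {ρ u Γ} w → Fresh u Γ → Realises ρ Γ → Realises (ρ [ u ≔ w ]) Γ
  Realises-update {ρ} {u} w fresh r = All.zipWith keep (fresh , r)
    where
    keep : ∀ {n} → ¬ Occurs u n × Holds ρ n → Holds (ρ [ u ≔ w ]) n
    keep {n} (u∉n , h) = Holds-cong n (λ y∈n → update-≢ ρ {u} w λ { refl → u∉n y∈n }) h

  fresh⇒≢ : ∀ {u Γ S A x} → Fresh u Γ → lab S A x ∈ Γ → x ≢ u
  fresh⇒≢ fresh m x≡u = lookup fresh m (sym x≡u)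

  Realises-TR : ∀ {σ x y z a b c Δ} → σ x ≡ a → σ y ≡ b → σ z ≡ c → R a b c →
                Realises σ Δ → Realises σ (TR x y z ++' Δ)
  Realises-TR refl refl refl (a≤b , a≤c , b≰c , c≰b) r = a≤b ∷ a≤c ∷ b≰c ∷ c≰b ∷ r

  record FreshPairUpdate (ρ : Assignment) (Γ : Branch) (x u v : ℕ) (w₁ w₂ : W) : Set where
    field
      σ          : Assignment
      σ-x        : σ x ≡ ρ x
      σ-u        : σ u ≡ w₁
      σ-v        : σ v ≡ w₂
      σ-realises : Realises σ Γ

  freshPairUpdate : ∀ {ρ Γ S A x u v} w₁ w₂ → lab S A x ∈ Γ →
                    Fresh u Γ → Fresh v Γ → u ≢ v → Realises ρ Γ →
                    FreshPairUpdate ρ Γ x u v w₁ w₂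
  freshPairUpdate {ρ} {u = u} {v} w₁ w₂ m fu fv u≢v r = record
    { σ          = ρ [ u ≔ w₁ ] [ v ≔ w₂ ]
    ; σ-x        = trans (update-≢ _ w₂ (fresh⇒≢ fv m)) (update-≢ ρ w₁ (fresh⇒≢ fu m))
    ; σ-u        = trans (update-≢ _ w₂ u≢v) (update-≡ ρ u w₁)
    ; σ-v        = update-≡ _ v w₂
    ; σ-realises = Realises-update w₂ fv (Realises-update w₁ fu r)
    }

  F□-sound : ∀ {Γ A x} u → lab F (□ A) x ∈ Γ → Fresh u Γ →
             Unrealisable (le T x u ∷ lab F A u ∷ Γ) → Unrealisable Γ
  F□-sound {A = A} u m fresh refute ρ r = lookup r m λ w x≤w → dne λ ⊮A →
    refute (ρ [ u ≔ w ])
      ( ≤-resp (update-≢ ρ w (fresh⇒≢ fresh m)) (update-≡ ρ u w) x≤w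
      ∷ ⊩-resp F A (update-≡ ρ u w) ⊮A
      ∷ Realises-update w fresh r)

  T✱-sound : ∀ {Γ A B x} u v → lab T (A ✱ B) x ∈ Γ → Fresh u Γ → Fresh v Γ → u ≢ v →
             Unrealisable (TR x u v ++' lab T A u ∷ lab T B v ∷ Γ) → Unrealisable Γ
  T✱-sound {A = A} {B} u v m fu fv u≢v refute ρ r =
    let (w₁ , w₂ , R-x , ⊩A , ⊩B) = lookup r m
        open FreshPairUpdate (freshPairUpdate w₁ w₂ m fu fv u≢v r)
    in refute σ (Realises-TR σ-x σ-u σ-v R-x
         (⊩-resp T A σ-u ⊩A ∷ ⊩-resp T B σ-v ⊩B ∷ σ-realises))

  F-✱-sound : ∀ {Γ A B x} u v → lab F (A -✱ B) x ∈ Γ → Fresh u Γ → Fresh v Γ → u ≢ v →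
              Unrealisable (TR v x u ++' lab T A u ∷ lab F B v ∷ Γ) → Unrealisable Γ
  F-✱-sound {A = A} {B} u v m fu fv u≢v refute ρ r = lookup r m λ w₁ w₂ R-x ⊩A → dne λ ⊮B →
    let open FreshPairUpdate (freshPairUpdate w₁ w₂ m fu fv u≢v r)
    in refute σ (Realises-TR σ-v σ-x σ-u R-x
         (⊩-resp T A σ-u ⊩A ∷ ⊩-resp F B σ-v ⊮B ∷ σ-realises))

  closes⇒unrealisable : ∀ {Γ} → Closes Γ → Unrealisable Γ
  closes⇒unrealisable (closeF mT mF) ρ r = lookup r mF (lookup r mT)
  closes⇒unrealisable (closeC mT mF) ρ r = lookup r mF (lookup r mT)
  closes⇒unrealisable (F¬ m c) ρ r = lookup r m λ ⊩A → closes⇒unrealisable c ρ (⊩A ∷ r)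
  closes⇒unrealisable (T¬ m c) ρ r = closes⇒unrealisable c ρ (lookup r m ∷ r)
  closes⇒unrealisable (T∧ m c) ρ r =
    let (⊩A , ⊩B) = lookup r m in closes⇒unrealisable c ρ (⊩A ∷ ⊩B ∷ r)
  closes⇒unrealisable (F∧ m c₁ c₂) ρ r =
    closes⇒unrealisable c₁ ρ ((λ ⊩A →
      closes⇒unrealisable c₂ ρ ((λ ⊩B → lookup r m (⊩A , ⊩B)) ∷ r)) ∷ r)
  closes⇒unrealisable (F□ u m fresh c) =
    F□-sound u m fresh (closes⇒unrealisable c)
  closes⇒unrealisable (T□ m x≤y c) ρ r =
    closes⇒unrealisable c ρ (lookup r m _ (lookup r x≤y) ∷ r)
  closes⇒unrealisable (T✱ u v m fu fv u≢v c) =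
    T✱-sound u v m fu fv u≢v (closes⇒unrealisable c)
  closes⇒unrealisable (F✱ {y = y} {z} m x≤y x≤z y≰z z≰y c₁ c₂) ρ r =
    closes⇒unrealisable c₁ ρ ((λ ⊩A →
      closes⇒unrealisable c₂ ρ ((λ ⊩B → lookup r m (ρ y , ρ z , R-x , ⊩A , ⊩B)) ∷ r)) ∷ r)
    where R-x = lookup r x≤y , lookup r x≤z , lookup r y≰z , lookup r z≰y
  closes⇒unrealisable (T-✱ {y = y} {z} m z≤x z≤y x≰y y≰x c₁ c₂) ρ r =
    closes⇒unrealisable c₁ ρ ((λ ⊩A →
      closes⇒unrealisable c₂ ρ (lookup r m (ρ y) (ρ z) R-z ⊩A ∷ r)) ∷ r)
    where R-z = lookup r z≤x , lookup r z≤y , lookup r x≰y , lookup r y≰x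
  closes⇒unrealisable (F-✱ u v m fu fv u≢v c) =
    F-✱-sound u v m fu fv u≢v (closes⇒unrealisable c)
  closes⇒unrealisable (eqL {S} {A} m x≤y y≤x c) ρ r =
    closes⇒unrealisable c ρ
      (⊩-resp S A (antisym (lookup r y≤x) (lookup r x≤y)) (lookup r m) ∷ r)
  closes⇒unrealisable (cmp _ _ c₁ c₂ c₃) ρ r =
    closes⇒unrealisable c₃ ρ
      ( (λ x≤y → closes⇒unrealisable c₁ ρ (x≤y ∷ r))
      ∷ (λ y≤x → closes⇒unrealisable c₂ ρ (y≤x ∷ r))
      ∷ r)
  closes⇒unrealisable (refl≤ _ c) ρ r = closes⇒unrealisable c ρ (≤-refl ∷ r)
  closes⇒unrealisable (trans≤ x≤y y≤z c) ρ r =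
    closes⇒unrealisable c ρ (≤-trans (lookup r x≤y) (lookup r y≤z) ∷ r)
  closes⇒unrealisable (sep {x₁} {x₂} {y} x₁≰x₂ x₂≰x₁ x₁≤y c) ρ r =
    let (x₂≰y , y≰x₂) =
          persistent (ρ x₁) (ρ x₂) (ρ y) (lookup r x₁≰x₂ , lookup r x₂≰x₁) (lookup r x₁≤y)
    in closes⇒unrealisable c ρ (y≰x₂ ∷ x₂≰y ∷ r)

mainTheorem4 : ExcludedMiddle 0ℓ → (A : Formula) → ProvableTBL A → Valid A
mainTheorem4 em A (_ , closes) M w =
  em⇒dne em λ ⊮A → closes⇒unrealisable closes (λ _ → w) (⊮A ∷ [])
  where open Soundness (em⇒dne em) M
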